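{- Let $(P,\le,{}',0,1)$ be a bounded strictly modular poset with a complementation $'$, and put \[ M(x,y):=L(U(x,y'),y),\qquad R(x,y):=LU(L(x,y),x') \] for all $x,y\in P$. Then $(P,\le,{}',M,R,0,1)$ is a divisible operator left residuated poset.
   Context: For a poset $(P,\le)$ and $A\subseteq P$, $L(A)=\{x\in P\mid x\le y \text{ for all } y\in A\}$ and $U(A)=\{x\in P\mid x\ge y\text{ for all }y\in A\}$; one writes $L(a,b)$ for $L(\{a,b\})$, $L(a,A)$ for $L(\{a\}\cup A)$, $L(A,B)$ for $L(A\cup B)$, $LU(A)$ for $L(U(A))$, and similarly. For $a\in P$, $A\subseteq P$, $a\le A$ means $a\le y$ for all $y\in A$, and $A\le a$ means $y\le a$ for all $y\in A$. A poset is strictly modular if for all $x,y,z\in P$ and $X,Z\subseteq P$: (1) if $x\le Z$ then $L(U(x,y),Z)=LU(x,L(y,Z))$; (2) if $L(X)\le z$ then $L(U(L(X),y),z)=LU(L(X),L(y,z))$. A unary operation $'$ on a bounded poset $(P,\le,0,1)$ is a complementation if $U(x,x')=\{1\}$ and $L(x,x')=\{0\}$ for all $x$. An operator left residuated poset is a tuple $(P,\le,{}',M,R,0,1)$ where $(P,\le,{}',0,1)$ is a bounded poset with a unary operation and $M,R:P^2\to 2^P$ satisfy for all $x,y,z\in P$: (i) $M(x,1)=M(1,x)=L(x)$; (ii) $M(x,y)\subseteq L(z)$ if and only if $L(x)\subseteq R(y,z)$; (iii) $R(x,0)=L(x')$. It is divisible if $M(R(x,y),x)=L(x,y)$ for all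 $x,y$, where $M$ with a set as first argument is understood via the defining formula, $M(A,y)=L(U(A,y'),y)$. -}

module Defs where

open import Level using (Level; _⊔_)
open import Data.Product using (_×_; _,_)
open import Data.Sum using (_⊎_)
open import Relation.Unary using (Pred; _⊆_; _∈_)
open import Relation.Binary.Bundles using (Poset)

module PosetNotions {c ℓ₁ ℓ₂ : Level} (P : Poset c ℓ₁ ℓ₂) where
  open Poset P public

  ℓs : Level
  ℓs = c ⊔ ℓ₁ ⊔ ℓ₂

  Subset : Set (Level.suc ℓs)
  Subset = Pred Carrier ℓs

  _≐_ : Subset → Subset → Set ℓs
  A ≐ B = (A ⊆ B) × (B ⊆ A)

  ⟦_⟧ : Carrier → Subset
  ⟦ a ⟧ x = Level.Lift ℓs (x ≈ a)

  pair : Carrier → Carrier → Subset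
  pair a b x = Level.Lift ℓs ((x ≈ a) ⊎ (x ≈ b))

  _∪_ : Subset → Subset → Subset
  (A ∪ B) x = A x ⊎ B x

  infixr 6 _∪_

  L : Subset → Subset
  L A x = ∀ y → A y → x ≤ y

  U : Subset → Subset
  U A x = ∀ y → A y → y ≤ x

  _≤S_ : Carrier → Subset → Set ℓs
  a ≤S A = ∀ y → A y → a ≤ y

  _S≤_ : Subset → Carrier → Set ℓs
  A S≤ a = ∀ y → A y → y ≤ a

  -- strict modularity (conditions (1) and (2))
  StrictlyModular : Set (Level.suc ℓs)
  StrictlyModular =
    (∀ (x y : Carrier) (Z : Subset) → x ≤S Z →
       L (U (pair x y) ∪ Z) ≐ L (U (⟦ x ⟧ ∪ L (⟦ y ⟧ ∪ Z))))
    × (∀ (y z : Carrier) (X : Subset) → L X S≤ z →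
       L (U (L X ∪ ⟦ y ⟧) ∪ ⟦ z ⟧) ≐ L (U (L X ∪ L (pair y z))))

  module Bounded (0P 1P : Carrier) (_′ : Carrier → Carrier) where

    IsBounded : Set (c ⊔ ℓ₂)
    IsBounded = (∀ x → 0P ≤ x) × (∀ x → x ≤ 1P)

    IsComplementation : Set ℓs
    IsComplementation = ∀ x → (U (pair x (x ′)) ≐ ⟦ 1P ⟧) × (L (pair x (x ′)) ≐ ⟦ 0P ⟧)

    IsOperatorLeftResiduated : (M R : Carrier → Carrier → Subset) → Set ℓs
    IsOperatorLeftResiduated M R =
      (∀ x → (M x 1P ≐ L ⟦ x ⟧) × (M 1P x ≐ L ⟦ x ⟧))
      × (∀ x y z → (M x y ⊆ L ⟦ z ⟧ → L ⟦ x ⟧ ⊆ R y z)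
                 × (L ⟦ x ⟧ ⊆ R y z → M x y ⊆ L ⟦ z ⟧))
      × (∀ x → R x 0P ≐ L ⟦ x ′ ⟧)

    -- M extended to a set in its first argument: M(A,y) = L(U(A,y'),y)
    Mset : Subset → Carrier → Subset
    Mset A y = L (U (A ∪ ⟦ y ′ ⟧) ∪ ⟦ y ⟧)

    IsDivisible : (R : Carrier → Carrier → Subset) → Set ℓs
    IsDivisible R = ∀ x y → Mset (R x y) x ≐ L (pair x y)

    M₀ : Carrier → Carrier → Subset
    M₀ x y = L (U (pair x (y ′)) ∪ ⟦ y ⟧)

    R₀ : Carrier → Carrier → Subset
    R₀ x y = L (U (L (pair x y) ∪ ⟦ x ′ ⟧))

module Submission where

open import Defs
open import Level using (Level; lift; lower)
open import Data.Product using (_×_; _,_; proj₁; proj₂)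
open import Data.Sum using (inj₁; inj₂; swap)
open import Function using (_∘_)
open import Relation.Binary.Bundles using (Poset)
open import Relation.Unary using (_⊆_; _∈_)

-- Complementation makes 1 ≤ every upper bound of {y, y′}, so any x lies below U(y′, y) and
-- strict modularity (1) can be applied to x; condition (2), with X = {y, z}, collapses
-- L(U(L(y,z), y′), y) into L(z) because every element of L(y′, y) is 0. The residuation
-- law and divisibility then come down to monotonicity of the Galois connection L ⊣ U.

module Cones {c ℓ₁ ℓ₂ : Level} (P : Poset c ℓ₁ ℓ₂) where
  open PosetNotions P

  ⟦⟧-refl : ∀ {a} → a ∈ ⟦ a ⟧
  ⟦⟧-refl = lift Eq.refl

  pairˡ : ∀ {a b} → a ∈ pair a b
  pairˡ = lift (inj₁ Eq.refl)

  pairʳ : ∀ {a b} → b ∈ pair a b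
  pairʳ = lift (inj₂ Eq.refl)

  ∈⟦⟧⇒≤ : ∀ {a y} → y ∈ ⟦ a ⟧ → y ≤ a
  ∈⟦⟧⇒≤ y≈a = reflexive (lower y≈a)

  ∈⟦⟧⇒≥ : ∀ {a y} → y ∈ ⟦ a ⟧ → a ≤ y
  ∈⟦⟧⇒≥ y≈a = reflexive (Eq.sym (lower y≈a))

  ≤⇒∈L⟦⟧ : ∀ {w x} → w ≤ x → w ∈ L ⟦ x ⟧
  ≤⇒∈L⟦⟧ w≤x y y≈x = trans w≤x (∈⟦⟧⇒≥ y≈x)

  ∈L⟦⟧⇒≤ : ∀ {w x} → w ∈ L ⟦ x ⟧ → w ≤ x
  ∈L⟦⟧⇒≤ w∈L = w∈L _ ⟦⟧-refl

  ≤₂⇒∈L-pair : ∀ {w x y} → w ≤ x → w ≤ y → w ∈ L (pair x y)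
  ≤₂⇒∈L-pair w≤x w≤y v (lift (inj₁ v≈x)) = trans w≤x (reflexive (Eq.sym v≈x))
  ≤₂⇒∈L-pair w≤x w≤y v (lift (inj₂ v≈y)) = trans w≤y (reflexive (Eq.sym v≈y))

  ≥₂⇒∈U-pair : ∀ {w x y} → x ≤ w → y ≤ w → w ∈ U (pair x y)
  ≥₂⇒∈U-pair x≤w y≤w v (lift (inj₁ v≈x)) = trans (reflexive v≈x) x≤w
  ≥₂⇒∈U-pair x≤w y≤w v (lift (inj₂ v≈y)) = trans (reflexive v≈y) y≤w

  L-antitone : ∀ {A B : Subset} → A ⊆ B → L B ⊆ L A
  L-antitone A⊆B w∈LB y y∈A = w∈LB y (A⊆B y∈A)

  L-∪-comm : ∀ {A B : Subset} → L (A ∪ B) ⊆ L (B ∪ A)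
  L-∪-comm w∈L v v∈B∪A = w∈L v (swap v∈B∪A)

  L-∪ˡ-antitone : ∀ {A A′ B : Subset} → A ⊆ A′ → L (A′ ∪ B) ⊆ L (A ∪ B)
  L-∪ˡ-antitone A⊆A′ w∈L v (inj₁ v∈A) = w∈L v (inj₁ (A⊆A′ v∈A))
  L-∪ˡ-antitone A⊆A′ w∈L v (inj₂ v∈B) = w∈L v (inj₂ v∈B)

  U-antitone : ∀ {A B : Subset} → A ⊆ B → U B ⊆ U A
  U-antitone A⊆B w∈UB y y∈A = w∈UB y (A⊆B y∈A)

  LU-mono : ∀ {A B : Subset} → A ⊆ B → L (U A) ⊆ L (U B)
  LU-mono A⊆B = L-antitone (U-antitone A⊆B)

  ⊆LU : ∀ {A : Subset} → A ⊆ L (U A)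
  ⊆LU a∈A u u∈UA = u∈UA _ a∈A

  U⊆ULU : ∀ {A : Subset} → U A ⊆ U (L (U A))
  U⊆ULU u∈UA r r∈LUA = r∈LUA _ u∈UA

  ∈L⇒L⟦⟧⊆L : ∀ {A : Subset} {x} → x ∈ L A → L ⟦ x ⟧ ⊆ L A
  ∈L⇒L⟦⟧⊆L x∈LA w∈L⟦x⟧ y y∈A = trans (∈L⟦⟧⇒≤ w∈L⟦x⟧) (x∈LA y y∈A)

  L⟦⟧⊆⇒∈ : ∀ {A : Subset} {x} → L ⟦ x ⟧ ⊆ A → x ∈ A
  L⟦⟧⊆⇒∈ {x = x} L⟦x⟧⊆A = L⟦x⟧⊆A (≤⇒∈L⟦⟧ (refl {x}))

module Operators {c ℓ₁ ℓ₂ : Level} (P : Poset c ℓ₁ ℓ₂)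
    (0P 1P : Poset.Carrier P) (_′ : Poset.Carrier P → Poset.Carrier P) where
  open PosetNotions P
  open Bounded 0P 1P _′
  open Cones P

  module Complemented (bounded : IsBounded) (complementation : IsComplementation) where

    private
      0≤ : ∀ x → 0P ≤ x
      0≤ = proj₁ bounded

      ≤1 : ∀ x → x ≤ 1P
      ≤1 = proj₂ bounded

    lowerBound-complement⇒≤0 : ∀ {x w} → w ≤ x → w ≤ x ′ → w ≤ 0P
    lowerBound-complement⇒≤0 {x} w≤x w≤x′ =
      ∈⟦⟧⇒≤ (proj₁ (proj₂ (complementation x)) (≤₂⇒∈L-pair w≤x w≤x′))

    upperBound-complement⇒1≤ : ∀ {x u} → x ≤ u → x ′ ≤ u → 1P ≤ u
    upperBound-complement⇒1≤ {x} x≤u x′≤u =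
      ∈⟦⟧⇒≥ (proj₁ (proj₁ (complementation x)) (≥₂⇒∈U-pair x≤u x′≤u))

    1′≤ : ∀ x → 1P ′ ≤ x
    1′≤ x = trans (lowerBound-complement⇒≤0 (≤1 (1P ′)) refl) (0≤ x)

    L-complement-pair⊆L⟦⟧ : ∀ x z → L (pair (x ′) x) ⊆ L ⟦ z ⟧
    L-complement-pair⊆L⟦⟧ x z w∈L =
      ≤⇒∈L⟦⟧ (trans (lowerBound-complement⇒≤0 (w∈L x pairʳ) (w∈L (x ′) pairˡ)) (0≤ z))

    ∈L-U-complement-pair : ∀ x y → x ∈ L (U (pair (y ′) y))
    ∈L-U-complement-pair x y u u∈U =
      trans (≤1 x) (upperBound-complement⇒1≤ (u∈U y pairʳ) (u∈U (y ′) pairˡ))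

    M₀-x-1 : ∀ x → M₀ x 1P ≐ L ⟦ x ⟧
    M₀-x-1 x = (λ w∈M → ≤⇒∈L⟦⟧ (w∈M x (inj₁ (≥₂⇒∈U-pair refl (1′≤ x)))))
             , L⟦x⟧⊆M₀
      where
        L⟦x⟧⊆M₀ : L ⟦ x ⟧ ⊆ M₀ x 1P
        L⟦x⟧⊆M₀ w∈L u (inj₁ u∈U) = trans (∈L⟦⟧⇒≤ w∈L) (u∈U x pairˡ)
        L⟦x⟧⊆M₀ {w} w∈L u (inj₂ u≈1) = trans (≤1 w) (∈⟦⟧⇒≥ u≈1)

    M₀-1-x : ∀ x → M₀ 1P x ≐ L ⟦ x ⟧
    M₀-1-x x = (λ w∈M → ≤⇒∈L⟦⟧ (w∈M x (inj₂ ⟦⟧-refl)))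
             , L⟦x⟧⊆M₀
      where
        L⟦x⟧⊆M₀ : L ⟦ x ⟧ ⊆ M₀ 1P x
        L⟦x⟧⊆M₀ {w} w∈L u (inj₁ u∈U) = trans (≤1 w) (u∈U 1P pairˡ)
        L⟦x⟧⊆M₀ w∈L u (inj₂ u≈x) = trans (∈L⟦⟧⇒≤ w∈L) (∈⟦⟧⇒≥ u≈x)

    R₀-x-0 : ∀ x → R₀ x 0P ≐ L ⟦ x ′ ⟧
    R₀-x-0 x = (λ w∈R → ≤⇒∈L⟦⟧ (w∈R (x ′) x′∈U))
             , λ w∈L u u∈U → trans (∈L⟦⟧⇒≤ w∈L) (u∈U (x ′) (inj₂ ⟦⟧-refl))
      where
        x′∈U : x ′ ∈ U (L (pair x 0P) ∪ ⟦ x ′ ⟧)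
        x′∈U v (inj₁ v∈L) = trans (v∈L 0P pairʳ) (0≤ (x ′))
        x′∈U v (inj₂ v≈x′) = ∈⟦⟧⇒≤ v≈x′

    module StrictlyModularLaws (strictlyModular : StrictlyModular) where

      L-U-L-pair⊆L⟦⟧ : ∀ y z → L (U (L (pair y z) ∪ ⟦ y ′ ⟧) ∪ ⟦ y ⟧) ⊆ L ⟦ z ⟧
      L-U-L-pair⊆L⟦⟧ y z w∈L = ≤⇒∈L⟦⟧ (modular w∈L z z∈U)
        where
          modular : L (U (L (pair y z) ∪ ⟦ y ′ ⟧) ∪ ⟦ y ⟧) ⊆ L (U (L (pair y z) ∪ L (pair (y ′) y)))
          modular = proj₁ (proj₂ strictlyModular (y ′) y (pair y z) (λ v v∈L → v∈L y pairˡ))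
          z∈U : z ∈ U (L (pair y z) ∪ L (pair (y ′) y))
          z∈U v (inj₁ v∈L) = v∈L z pairʳ
          z∈U v (inj₂ v∈L) = ∈L⟦⟧⇒≤ (L-complement-pair⊆L⟦⟧ y z v∈L)

      M₀⊆L⟦⟧⇒∈R₀ : ∀ {x y z} → M₀ x y ⊆ L ⟦ z ⟧ → x ∈ R₀ y z
      M₀⊆L⟦⟧⇒∈R₀ {x} {y} {z} M⊆L = LU-mono generators⊆ (modular x∈L)
        where
          modular : L (U (pair (y ′) y) ∪ U (pair x (y ′)))
                  ⊆ L (U (⟦ y ′ ⟧ ∪ L (⟦ y ⟧ ∪ U (pair x (y ′)))))
          modular = proj₁ (proj₁ strictlyModular (y ′) y (U (pair x (y ′))) (λ v v∈U → v∈U (y ′) pairʳ))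
          x∈L : x ∈ L (U (pair (y ′) y) ∪ U (pair x (y ′)))
          x∈L u (inj₁ u∈U) = ∈L-U-complement-pair x y u u∈U
          x∈L u (inj₂ u∈U) = u∈U x pairˡ
          L-M⊆L-pair : L (⟦ y ⟧ ∪ U (pair x (y ′))) ⊆ L (pair y z)
          L-M⊆L-pair w∈L = ≤₂⇒∈L-pair (w∈L y (inj₁ ⟦⟧-refl)) (∈L⟦⟧⇒≤ (M⊆L (L-∪-comm w∈L)))
          generators⊆ : ⟦ y ′ ⟧ ∪ L (⟦ y ⟧ ∪ U (pair x (y ′))) ⊆ L (pair y z) ∪ ⟦ y ′ ⟧
          generators⊆ (inj₁ y′≈) = inj₂ y′≈
          generators⊆ (inj₂ w∈L) = inj₁ (L-M⊆L-pair w∈L)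

      ∈R₀⇒M₀⊆L⟦⟧ : ∀ {x y z} → x ∈ R₀ y z → M₀ x y ⊆ L ⟦ z ⟧
      ∈R₀⇒M₀⊆L⟦⟧ {x} {y} {z} x∈R = L-U-L-pair⊆L⟦⟧ y z ∘ L-∪ˡ-antitone U⊆U-pair
        where
          U⊆U-pair : U (L (pair y z) ∪ ⟦ y ′ ⟧) ⊆ U (pair x (y ′))
          U⊆U-pair u∈U = ≥₂⇒∈U-pair (x∈R _ u∈U) (u∈U (y ′) (inj₂ ⟦⟧-refl))

      residuated : ∀ x y z → (M₀ x y ⊆ L ⟦ z ⟧ → L ⟦ x ⟧ ⊆ R₀ y z)
                           × (L ⟦ x ⟧ ⊆ R₀ y z → M₀ x y ⊆ L ⟦ z ⟧)
      residuated x y z = ∈L⇒L⟦⟧⊆L ∘ M₀⊆L⟦⟧⇒∈R₀ , ∈R₀⇒M₀⊆L⟦⟧ ∘ L⟦⟧⊆⇒∈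

      divisible : IsDivisible R₀
      divisible x y = Mset⊆L-pair , L-pair⊆Mset
        where
          U⊆U-R₀ : U (L (pair x y) ∪ ⟦ x ′ ⟧) ⊆ U (R₀ x y ∪ ⟦ x ′ ⟧)
          U⊆U-R₀ u∈U r (inj₁ r∈R) = U⊆ULU u∈U r r∈R
          U⊆U-R₀ u∈U v (inj₂ v≈x′) = u∈U v (inj₂ v≈x′)
          Mset⊆L-pair : Mset (R₀ x y) x ⊆ L (pair x y)
          Mset⊆L-pair w∈M = ≤₂⇒∈L-pair (w∈M x (inj₂ ⟦⟧-refl))
                                       (∈L⟦⟧⇒≤ (L-U-L-pair⊆L⟦⟧ x y (L-∪ˡ-antitone U⊆U-R₀ w∈M)))
          L-pair⊆Mset : L (pair x y) ⊆ Mset (R₀ x y) x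
          L-pair⊆Mset w∈L u (inj₁ u∈U) = u∈U _ (inj₁ (⊆LU (inj₁ w∈L)))
          L-pair⊆Mset w∈L v (inj₂ v≈x) = trans (w∈L x pairˡ) (∈⟦⟧⇒≥ v≈x)

theorem9 : ∀ {c ℓ₁ ℓ₂ : Level} (P : Poset c ℓ₁ ℓ₂)
    (0P 1P : Poset.Carrier P) (_′ : Poset.Carrier P → Poset.Carrier P) →
    let open PosetNotions P in
    let open Bounded 0P 1P _′ in
    IsBounded → StrictlyModular → IsComplementation →
    IsOperatorLeftResiduated M₀ R₀ × IsDivisible R₀
theorem9 P 0P 1P _′ bounded strictlyModular complementation =
  ( (λ x → M₀-x-1 x , M₀-1-x x) , residuated , R₀-x-0 ) , divisible
  where
    open Operators P 0P 1P _′
    open Complemented bounded complementation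
    open StrictlyModularLaws strictlyModular
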